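{- For every $\mathbf{PL}(\text{⩔})$-formula $\phi$ there is a finite set $\{\alpha_i\mid i\in I\}$ of classical formulas such that $\phi\dashv\vdash\text{⩔}_{i\in I}\alpha_i$ in the natural deduction system for $\mathbf{PL}(\text{⩔})$ described below.
   Context: Classical formulas: $\alpha::=p\mid\bot\mid\neg\alpha\mid\alpha\wedge\alpha\mid\alpha\vee\alpha$. $\mathbf{PL}(\text{⩔})$-formulas: $\phi::=p\mid\bot\mid\neg\phi\mid\phi\wedge\phi\mid\phi\vee\phi\mid\phi\,\text{⩔}\,\phi$ (negation may apply to arbitrary formulas; $\vee$ is local and ⩔ global disjunction). $\text{⩔}_{i\in I}\alpha_i$ denotes the iterated global disjunction. The natural deduction system (with $\phi,\psi,\chi$ arbitrary and $\alpha$ ranging over classical formulas only; $[\cdot]$ marks discharged assumptions) has rules: $\bot$E: from $\bot$ infer $\phi$. $\wedge$I: from $\phi,\psi$ infer $\phi\wedge\psi$; $\wedge$E: from $\phi\wedge\psi$ infer $\phi$, and infer $\psi$. $\neg$I: from a derivation of $\bot$ from $[\phi]$ infer $\neg\phi$; $\neg$E: from $\phi$ and $\neg\phi$ infer $\psi$; RAA: from a derivation of $\bot$ from $[\neg\alpha]$ infer $\alpha$. ⩔I: from $\phi$ infer $\phi\,\text{⩔}\,\psi$ and $\psi\,\text{⩔}\,\phi$; ⩔E: from $\phi\,\text{⩔}\,\psi$, a derivation of $\chi$ from $[\phi]$ and one from $[\psi]$, infer $\chi$. $\vee$I: from $\phi$ infer $\phi\vee\psi$; $\vee$E: from $\phi\vee\psi$,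 a derivation of $\alpha$ from $[\phi]$ and one from $[\psi]$, infer $\alpha$; $\vee$Com: from $\phi\vee\psi$ infer $\psi\vee\phi$; $\vee$Mon: from $\phi\vee\psi$ and a derivation of $\chi$ from $[\phi]$, infer $\chi\vee\psi$. Dis$\vee$⩔: from $\phi\vee(\psi\,\text{⩔}\,\chi)$ infer $(\phi\vee\psi)\,\text{⩔}\,(\phi\vee\chi)$. $\phi\dashv\vdash\psi$ means $\phi\vdash\psi$ and $\psi\vdash\phi$. -}

module Defs where

open import Data.Nat using (ℕ)
open import Data.List using (List; _∷_; [])
open import Data.List.NonEmpty using (List⁺; foldr₁)
open import Data.List.Membership.Propositional using (_∈_)
open import Data.Product using (_×_)

infixr 6 _∧'_
infixr 5 _∨'_
infixr 4 _⩔_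
data Form : Set where
  var  : ℕ → Form
  ⊥'   : Form
  ¬'_  : Form → Form
  _∧'_ : Form → Form → Form
  _∨'_ : Form → Form → Form
  _⩔_  : Form → Form → Form

data Classical : Form → Set where
  c-var : ∀ n → Classical (var n)
  c-⊥   : Classical ⊥'
  c-¬   : ∀ {a} → Classical a → Classical (¬' a)
  c-∧   : ∀ {a b} → Classical a → Classical b → Classical (a ∧' b)
  c-∨   : ∀ {a b} → Classical a → Classical b → Classical (a ∨' b)

infix 2 _⊢_
data _⊢_ (Γ : List Form) : Form → Set where
  hyp   : ∀ {φ} → φ ∈ Γ → Γ ⊢ φ
  ⊥E    : ∀ {φ} → Γ ⊢ ⊥' → Γ ⊢ φ
  ∧I    : ∀ {φ ψ} → Γ ⊢ φ → Γ ⊢ ψ → Γ ⊢ φ ∧' ψ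
  ∧E₁   : ∀ {φ ψ} → Γ ⊢ φ ∧' ψ → Γ ⊢ φ
  ∧E₂   : ∀ {φ ψ} → Γ ⊢ φ ∧' ψ → Γ ⊢ ψ
  ¬I    : ∀ {φ} → (φ ∷ Γ) ⊢ ⊥' → Γ ⊢ ¬' φ
  ¬E    : ∀ {φ ψ} → Γ ⊢ φ → Γ ⊢ ¬' φ → Γ ⊢ ψ
  RAA   : ∀ {α} → Classical α → ((¬' α) ∷ Γ) ⊢ ⊥' → Γ ⊢ α
  ⩔I₁   : ∀ {φ ψ} → Γ ⊢ φ → Γ ⊢ φ ⩔ ψ
  ⩔I₂   : ∀ {φ ψ} → Γ ⊢ φ → Γ ⊢ ψ ⩔ φ
  ⩔E    : ∀ {φ ψ χ} → Γ ⊢ φ ⩔ ψ → (φ ∷ Γ) ⊢ χ → (ψ ∷ Γ) ⊢ χ → Γ ⊢ χ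
  ∨I    : ∀ {φ ψ} → Γ ⊢ φ → Γ ⊢ φ ∨' ψ
  ∨E    : ∀ {φ ψ α} → Classical α → Γ ⊢ φ ∨' ψ → (φ ∷ Γ) ⊢ α → (ψ ∷ Γ) ⊢ α → Γ ⊢ α
  ∨Com  : ∀ {φ ψ} → Γ ⊢ φ ∨' ψ → Γ ⊢ ψ ∨' φ
  ∨Mon  : ∀ {φ ψ χ} → Γ ⊢ φ ∨' ψ → (φ ∷ Γ) ⊢ χ → Γ ⊢ χ ∨' ψ
  Dis∨⩔ : ∀ {φ ψ χ} → Γ ⊢ φ ∨' (ψ ⩔ χ) → Γ ⊢ (φ ∨' ψ) ⩔ (φ ∨' χ)

_⊢₁_ : Form → Form → Set
φ ⊢₁ ψ = (φ ∷ []) ⊢ ψ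

_⊣⊢_ : Form → Form → Set
φ ⊣⊢ ψ = (φ ⊢₁ ψ) × (ψ ⊢₁ φ)

⩔-big : List⁺ Form → Form
⩔-big = foldr₁ _⩔_

{-# OPTIONS --safe #-}
-- A global disjunction concatenates
-- the lists; ∧ and ∨ take all pairwise combinations, since both are monotone and distribute
-- over ⩔ on either side (for ∨ this is Dis∨⩔). For a negation one disjunct suffices:
-- if φ ⊣⊢ ⩔ᵢ αᵢ then ¬φ ⊣⊢ ¬(⋁ᵢ αᵢ) with ⋁ the local disjunction. One direction uses
-- ⩔ᵢ αᵢ ⊢ ⋁ᵢ αᵢ, the other eliminates ⋁ᵢ αᵢ by ∨E, which is allowed because ⊥ is classical.
module Submission where

open import Defs
open import Function using (flip)
open import Data.List using (List; []; _∷_; cartesianProductWith; map; _++_)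
open import Data.List.NonEmpty using (List⁺; _∷_; [_]; toList; foldr₁; _⁺++⁺_)
open import Data.List.Relation.Unary.All using (All; []; _∷_; lookup)
import Data.List.Relation.Unary.All.Properties as All
open import Data.List.Relation.Unary.Any using (here; there)
open import Data.List.Membership.Propositional using (_∈_)
open import Data.List.Membership.Propositional.Properties
  using (∈-cartesianProductWith⁺; ∈-cartesianProductWith⁻; ∈-++⁺ˡ; ∈-++⁺ʳ; ∈-++⁻)
open import Data.List.Relation.Binary.Subset.Propositional using (_⊆_)
open import Data.List.Relation.Binary.Subset.Propositional.Properties using (xs⊆x∷xs; ∷⁺ʳ)
open import Data.Product using (Σ; _×_; _,_)
open import Data.Sum using (inj₁; inj₂)
open import Relation.Binary.PropositionalEquality using (refl; setoid)

private
  variable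
    Γ Δ : List Form
    φ ψ χ θ : Form

rename : Γ ⊆ Δ → Γ ⊢ φ → Δ ⊢ φ
rename ρ (hyp p) = hyp (ρ p)
rename ρ (⊥E d) = ⊥E (rename ρ d)
rename ρ (∧I d e) = ∧I (rename ρ d) (rename ρ e)
rename ρ (∧E₁ d) = ∧E₁ (rename ρ d)
rename ρ (∧E₂ d) = ∧E₂ (rename ρ d)
rename ρ (¬I d) = ¬I (rename (∷⁺ʳ _ ρ) d)
rename ρ (¬E d e) = ¬E (rename ρ d) (rename ρ e)
rename ρ (RAA c d) = RAA c (rename (∷⁺ʳ _ ρ) d)
rename ρ (⩔I₁ d) = ⩔I₁ (rename ρ d)
rename ρ (⩔I₂ d) = ⩔I₂ (rename ρ d)
rename ρ (⩔E d e f) = ⩔E (rename ρ d) (rename (∷⁺ʳ _ ρ) e) (rename (∷⁺ʳ _ ρ) f)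
rename ρ (∨I d) = ∨I (rename ρ d)
rename ρ (∨E c d e f) = ∨E c (rename ρ d) (rename (∷⁺ʳ _ ρ) e) (rename (∷⁺ʳ _ ρ) f)
rename ρ (∨Com d) = ∨Com (rename ρ d)
rename ρ (∨Mon d e) = ∨Mon (rename ρ d) (rename (∷⁺ʳ _ ρ) e)
rename ρ (Dis∨⩔ d) = Dis∨⩔ (rename ρ d)

weaken : Γ ⊢ φ → (ψ ∷ Γ) ⊢ φ
weaken = rename (xs⊆x∷xs _ _)

weaken₁ : (χ ∷ Γ) ⊢ φ → (χ ∷ ψ ∷ Γ) ⊢ φ
weaken₁ = rename (∷⁺ʳ _ (xs⊆x∷xs _ _))

assumption : (φ ∷ Γ) ⊢ φ
assumption = hyp (here refl)

cut : Γ ⊢ φ → (φ ∷ Γ) ⊢ ψ → Γ ⊢ ψ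
cut {φ = φ} d e = ⩔E (⩔I₁ {ψ = φ} d) e e

contraposition : (φ ∷ Γ) ⊢ ψ → Γ ⊢ ¬' ψ → Γ ⊢ ¬' φ
contraposition d e = ¬I (¬E d (weaken e))

Monotone : (Form → Form → Form) → Set
Monotone _∙_ = ∀ {Γ φ ψ φ′ ψ′} → Γ ⊢ φ ∙ ψ → (φ ∷ Γ) ⊢ φ′ → (ψ ∷ Γ) ⊢ ψ′ → Γ ⊢ φ′ ∙ ψ′

DistributesOverˡ-⩔ : (Form → Form → Form) → Set
DistributesOverˡ-⩔ _∙_ = ∀ {Γ φ ψ χ} → Γ ⊢ φ ∙ (ψ ⩔ χ) → Γ ⊢ (φ ∙ ψ) ⩔ (φ ∙ χ)

DistributesOverʳ-⩔ : (Form → Form → Form) → Set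
DistributesOverʳ-⩔ _∙_ = ∀ {Γ φ ψ χ} → Γ ⊢ (ψ ⩔ χ) ∙ φ → Γ ⊢ (ψ ∙ φ) ⩔ (χ ∙ φ)

∧-mono : Monotone _∧'_
∧-mono d e f = ∧I (cut (∧E₁ d) e) (cut (∧E₂ d) f)

∨-mono : Monotone _∨'_
∨-mono d e f = ∨Com (∨Mon (∨Com (∨Mon d e)) f)

⩔-mono : Monotone _⩔_
⩔-mono d e f = ⩔E d (⩔I₁ e) (⩔I₂ f)

∧-distribˡ-⩔ : DistributesOverˡ-⩔ _∧'_
∧-distribˡ-⩔ d = ⩔E (∧E₂ d) (⩔I₁ (∧I (∧E₁ (weaken d)) assumption))
                            (⩔I₂ (∧I (∧E₁ (weaken d)) assumption))

∧-distribʳ-⩔ : DistributesOverʳ-⩔ _∧'_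
∧-distribʳ-⩔ d = ⩔E (∧E₁ d) (⩔I₁ (∧I assumption (∧E₂ (weaken d))))
                            (⩔I₂ (∧I assumption (∧E₂ (weaken d))))

∨-distribˡ-⩔ : DistributesOverˡ-⩔ _∨'_
∨-distribˡ-⩔ = Dis∨⩔

∨-distribʳ-⩔ : DistributesOverʳ-⩔ _∨'_
∨-distribʳ-⩔ d = ⩔-mono (Dis∨⩔ (∨Com d)) (∨Com assumption) (∨Com assumption)

foldr₁-intro : (_∙_ : Form → Form → Form) →
               (∀ {Γ φ ψ} → Γ ⊢ φ → Γ ⊢ φ ∙ ψ) → (∀ {Γ φ ψ} → Γ ⊢ ψ → Γ ⊢ φ ∙ ψ) →
               ∀ A → φ ∈ toList A → Γ ⊢ φ → Γ ⊢ foldr₁ _∙_ A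
foldr₁-intro _∙_ inl inr (a ∷ [])     (here refl) d = d
foldr₁-intro _∙_ inl inr (a ∷ b ∷ bs) (here refl) d = inl d
foldr₁-intro _∙_ inl inr (a ∷ b ∷ bs) (there p)   d = inr (foldr₁-intro _∙_ inl inr (b ∷ bs) p d)

foldr₁-elim : (_∙_ : Form → Form → Form) →
              (∀ {Γ φ ψ} → Γ ⊢ φ ∙ ψ → (φ ∷ Γ) ⊢ χ → (ψ ∷ Γ) ⊢ χ → Γ ⊢ χ) →
              ∀ A → Γ ⊢ foldr₁ _∙_ A → (∀ {a} → a ∈ toList A → (a ∷ Γ) ⊢ χ) → Γ ⊢ χ
foldr₁-elim {χ = χ} _∙_ elim (a ∷ as) = go a as
  where
  go : ∀ {Γ} a as → Γ ⊢ foldr₁ _∙_ (a ∷ as) → (∀ {x} → x ∈ a ∷ as → (x ∷ Γ) ⊢ χ) → Γ ⊢ χ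
  go a []       d k = cut d (k (here refl))
  go a (b ∷ bs) d k = elim d (k (here refl)) (go b bs assumption (λ p → weaken₁ (k (there p))))

⩔-big-intro : ∀ A → φ ∈ toList A → Γ ⊢ φ → Γ ⊢ ⩔-big A
⩔-big-intro = foldr₁-intro _⩔_ ⩔I₁ ⩔I₂

⩔-big-elim : ∀ A → Γ ⊢ ⩔-big A → (∀ {a} → a ∈ toList A → (a ∷ Γ) ⊢ χ) → Γ ⊢ χ
⩔-big-elim = foldr₁-elim _⩔_ ⩔E

∨-big : List⁺ Form → Form
∨-big = foldr₁ _∨'_

∨-big-intro : ∀ A → φ ∈ toList A → Γ ⊢ φ → Γ ⊢ ∨-big A
∨-big-intro = foldr₁-intro _∨'_ ∨I (λ d → ∨Com (∨I d))

∨-big-elim : Classical χ →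
             ∀ A → Γ ⊢ ∨-big A → (∀ {a} → a ∈ toList A → (a ∷ Γ) ⊢ χ) → Γ ⊢ χ
∨-big-elim c = foldr₁-elim _∨'_ (∨E c)

∨-big-classical : ∀ A → All Classical (toList A) → Classical (∨-big A)
∨-big-classical (a ∷ [])     (c ∷ [])  = c
∨-big-classical (a ∷ b ∷ bs) (c ∷ cs) = c-∨ c (∨-big-classical (b ∷ bs) cs)

⩔-big⇒∨-big : ∀ A → Γ ⊢ ⩔-big A → Γ ⊢ ∨-big A
⩔-big⇒∨-big A d = ⩔-big-elim A d (λ p → ∨-big-intro A p assumption)

¬⩔-big⇒¬∨-big : ∀ A → Γ ⊢ ¬' ⩔-big A → Γ ⊢ ¬' ∨-big A
¬⩔-big⇒¬∨-big A d =
  ¬I (∨-big-elim c-⊥ A assumption (λ p → ¬E (⩔-big-intro A p assumption) (weaken (weaken d))))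

⩔-big-++⁺ : ∀ A B → Γ ⊢ ⩔-big A ⩔ ⩔-big B → Γ ⊢ ⩔-big (A ⁺++⁺ B)
⩔-big-++⁺ A B d =
  ⩔E d (⩔-big-elim A assumption (λ p → ⩔-big-intro (A ⁺++⁺ B) (∈-++⁺ˡ p) assumption))
       (⩔-big-elim B assumption (λ p → ⩔-big-intro (A ⁺++⁺ B) (∈-++⁺ʳ (toList A) p) assumption))

⩔-big-++⁻ : ∀ A B → Γ ⊢ ⩔-big (A ⁺++⁺ B) → Γ ⊢ ⩔-big A ⩔ ⩔-big B
⩔-big-++⁻ A B d = ⩔-big-elim (A ⁺++⁺ B) d split
  where
  split : ∀ {x} → x ∈ toList (A ⁺++⁺ B) → (x ∷ Γ) ⊢ ⩔-big A ⩔ ⩔-big B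
  split p with ∈-++⁻ (toList A) p
  ... | inj₁ q = ⩔I₁ (⩔-big-intro A q assumption)
  ... | inj₂ q = ⩔I₂ (⩔-big-intro B q assumption)

-- Thanks to η for List⁺, toList (cartesianProductWith⁺ f A B) is definitionally
-- cartesianProductWith f (toList A) (toList B).
cartesianProductWith⁺ : (Form → Form → Form) → List⁺ Form → List⁺ Form → List⁺ Form
cartesianProductWith⁺ f (a ∷ as) (b ∷ bs) = f a b ∷ (map (f a) bs ++ cartesianProductWith f as (b ∷ bs))

All-cartesianProductWith⁺ : ∀ {P : Form → Set} f A B → (∀ {a b} → P a → P b → P (f a b)) →
                            All P (toList A) → All P (toList B) →
                            All P (toList (cartesianProductWith⁺ f A B))
All-cartesianProductWith⁺ f A B closed pas pbs =
  All.cartesianProductWith⁺ (setoid Form) (setoid Form) f (toList A) (toList B)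
    (λ p q → closed (lookup pas p) (lookup pbs q))

distrib-⩔-big-elim : (_∙_ : Form → Form → Form) → DistributesOverˡ-⩔ _∙_ →
                     ∀ B → Γ ⊢ φ ∙ ⩔-big B → (∀ {b} → b ∈ toList B → ((φ ∙ b) ∷ Γ) ⊢ θ) → Γ ⊢ θ
distrib-⩔-big-elim {φ = φ} {θ = θ} _∙_ dist (b ∷ bs) = go b bs
  where
  go : ∀ {Γ} b bs → Γ ⊢ φ ∙ ⩔-big (b ∷ bs) → (∀ {x} → x ∈ b ∷ bs → ((φ ∙ x) ∷ Γ) ⊢ θ) → Γ ⊢ θ
  go b []       d k = cut d (k (here refl))
  go b (c ∷ cs) d k = ⩔E (dist d) (k (here refl)) (go c cs assumption (λ p → weaken₁ (k (there p))))

⩔-big-cartesianProduct⁺ : (_∙_ : Form → Form → Form) →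
                          DistributesOverˡ-⩔ _∙_ → DistributesOverʳ-⩔ _∙_ → ∀ A B →
                          Γ ⊢ ⩔-big A ∙ ⩔-big B → Γ ⊢ ⩔-big (cartesianProductWith⁺ _∙_ A B)
⩔-big-cartesianProduct⁺ _∙_ distˡ distʳ A B d =
  distrib-⩔-big-elim (flip _∙_) distʳ A d (λ pa →
    distrib-⩔-big-elim _∙_ distˡ B assumption (λ pb →
      ⩔-big-intro (cartesianProductWith⁺ _∙_ A B) (∈-cartesianProductWith⁺ _∙_ pa pb) assumption))

⩔-big-cartesianProduct⁻ : (_∙_ : Form → Form → Form) → Monotone _∙_ → ∀ A B →
                          Γ ⊢ ⩔-big (cartesianProductWith⁺ _∙_ A B) → Γ ⊢ ⩔-big A ∙ ⩔-big B
⩔-big-cartesianProduct⁻ _∙_ mono A B d = ⩔-big-elim (cartesianProductWith⁺ _∙_ A B) d split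
  where
  split : ∀ {x} → x ∈ toList (cartesianProductWith⁺ _∙_ A B) → (x ∷ Γ) ⊢ ⩔-big A ∙ ⩔-big B
  split p with ∈-cartesianProductWith⁻ _∙_ (toList A) (toList B) p
  ... | a , b , pa , pb , refl =
    mono assumption (⩔-big-intro A pa assumption) (⩔-big-intro B pb assumption)

disjuncts : Form → List⁺ Form
disjuncts (var n)  = [ var n ]
disjuncts ⊥'       = [ ⊥' ]
disjuncts (¬' φ)   = [ ¬' ∨-big (disjuncts φ) ]
disjuncts (φ ∧' ψ) = cartesianProductWith⁺ _∧'_ (disjuncts φ) (disjuncts ψ)
disjuncts (φ ∨' ψ) = cartesianProductWith⁺ _∨'_ (disjuncts φ) (disjuncts ψ)
disjuncts (φ ⩔ ψ)  = disjuncts φ ⁺++⁺ disjuncts ψ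

disjuncts-classical : ∀ φ → All Classical (toList (disjuncts φ))
disjuncts-classical (var n)  = c-var n ∷ []
disjuncts-classical ⊥'       = c-⊥ ∷ []
disjuncts-classical (¬' φ)   = c-¬ (∨-big-classical (disjuncts φ) (disjuncts-classical φ)) ∷ []
disjuncts-classical (φ ∧' ψ) = All-cartesianProductWith⁺ _∧'_ (disjuncts φ) (disjuncts ψ) c-∧
                                 (disjuncts-classical φ) (disjuncts-classical ψ)
disjuncts-classical (φ ∨' ψ) = All-cartesianProductWith⁺ _∨'_ (disjuncts φ) (disjuncts ψ) c-∨
                                 (disjuncts-classical φ) (disjuncts-classical ψ)
disjuncts-classical (φ ⩔ ψ)  = All.++⁺ (disjuncts-classical φ) (disjuncts-classical ψ)

to-disjuncts   : ∀ φ → Γ ⊢ φ → Γ ⊢ ⩔-big (disjuncts φ)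
from-disjuncts : ∀ φ → Γ ⊢ ⩔-big (disjuncts φ) → Γ ⊢ φ

to-disjuncts (var n)  d = d
to-disjuncts ⊥'       d = d
to-disjuncts (¬' φ)   d =
  ¬⩔-big⇒¬∨-big (disjuncts φ) (contraposition (from-disjuncts φ assumption) d)
to-disjuncts (φ ∧' ψ) d =
  ⩔-big-cartesianProduct⁺ _∧'_ ∧-distribˡ-⩔ ∧-distribʳ-⩔ (disjuncts φ) (disjuncts ψ)
    (∧-mono d (to-disjuncts φ assumption) (to-disjuncts ψ assumption))
to-disjuncts (φ ∨' ψ) d =
  ⩔-big-cartesianProduct⁺ _∨'_ ∨-distribˡ-⩔ ∨-distribʳ-⩔ (disjuncts φ) (disjuncts ψ)
    (∨-mono d (to-disjuncts φ assumption) (to-disjuncts ψ assumption))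
to-disjuncts (φ ⩔ ψ)  d =
  ⩔-big-++⁺ (disjuncts φ) (disjuncts ψ)
    (⩔-mono d (to-disjuncts φ assumption) (to-disjuncts ψ assumption))

from-disjuncts (var n)  d = d
from-disjuncts ⊥'       d = d
from-disjuncts (¬' φ)   d =
  contraposition (⩔-big⇒∨-big (disjuncts φ) (to-disjuncts φ assumption)) d
from-disjuncts (φ ∧' ψ) d =
  ∧-mono (⩔-big-cartesianProduct⁻ _∧'_ ∧-mono (disjuncts φ) (disjuncts ψ) d)
    (from-disjuncts φ assumption) (from-disjuncts ψ assumption)
from-disjuncts (φ ∨' ψ) d =
  ∨-mono (⩔-big-cartesianProduct⁻ _∨'_ ∨-mono (disjuncts φ) (disjuncts ψ) d)
    (from-disjuncts φ assumption) (from-disjuncts ψ assumption)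
from-disjuncts (φ ⩔ ψ)  d =
  ⩔-mono (⩔-big-++⁻ (disjuncts φ) (disjuncts ψ) d)
    (from-disjuncts φ assumption) (from-disjuncts ψ assumption)

mainTheorem9 : (φ : Form) → Σ (List⁺ Form) (λ αs → All Classical (toList αs) × (φ ⊣⊢ ⩔-big αs))
mainTheorem9 φ =
  disjuncts φ , disjuncts-classical φ , to-disjuncts φ assumption , from-disjuncts φ assumption
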